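{- Let $S_0,S_1,S_2$ be positive integers, and define $k_1=\tfrac12S_0-S_1+\tfrac12S_2$, $k_2=\tfrac12S_0-\tfrac12S_2$, $k_3=-\tfrac12S_0+\tfrac12S_2$, $k_4=S_0-S_1$, $k_5=-S_1+S_2$, $k_6=0$, $k=\max\{|k_i|:1\le i\le 6\}$, and $l=\left\lceil\frac{2(k+1)}{\min\{S_1,k_1+S_1\}}\right\rceil$. Let $F[n]=k_1+S_1$ if $\mathbf f[n]=0$ and $F[n]=S_1$ if $\mathbf f[n]=1$ ($n\ge1$), and for $i\ge1$ let \[R(F[i,i+l-1])=\textstyle\sum_{q=1}^{i-1}F[q]+\left[k+1,\ \sum_{q=i}^{i+l}F[q]-(k+1)\right].\] If $x\in R(F[i,i+l-1])$, then for every $s\ge0$ and every $j\in\{1,\dots,6\}$, \[x\ne \textstyle\sum_{q=1}^{i-1-s}F[q]+k_j\quad\text{and}\quad x\ne\sum_{q=1}^{i+l+s}F[q]+k_j.\]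
   Context: $\varphi=(1+\sqrt5)/2$, $\alpha=2-\varphi$, and $\mathbf{f}=(\lfloor (n+1)\alpha\rfloor-\lfloor n\alpha\rfloor)_{n\ge1}$ is the Fibonacci word with $n$-th letter $\mathbf f[n]$. For $c\in\mathbb R$ and an interval $A$, $c+A=\{c+a:a\in A\}$; sums with upper index smaller than the lower index are $0$.
   Formalization: The point x in $R(F[i,i+l-1])$ ranges over the rationals rather than the reals. -}

module Defs where

open import Data.Bool using (Bool; true; false; _∧_; if_then_else_)
open import Data.Nat as ℕ using (ℕ; zero; suc)
open import Data.Integer as ℤ using (ℤ; +_)
open import Data.Rational as ℚ using (ℚ; 0ℚ; 1ℚ; ½; _+_; _-_; _*_; -_; _⊔_; _⊓_; _÷_; ∣_∣; ceiling)
open import Data.Rational.Properties renaming (_≟_ to _≟ℚ_) using ()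
open import Data.Product using (_×_)
open import Data.Fin using (Fin; zero; suc)
open import Data.List using (List; foldr; map; applyUpTo)
open import Relation.Nullary using (yes; no)

-- Fibonacci word, computed exactly from α = 2 - φ = (3 - √5)/2.

-- For n, m ∈ ℕ:  m ≤ n·α  ⟺  2m ≤ 3n  and  5n² ≤ (3n - 2m)²
-- (since n·α = (3n - n√5)/2).
leα : ℕ → ℕ → Bool
leα n m = (2 ℕ.* m ℕ.≤ᵇ 3 ℕ.* n) ∧
          (5 ℕ.* n ℕ.* n ℕ.≤ᵇ (3 ℕ.* n ℕ.∸ 2 ℕ.* m) ℕ.* (3 ℕ.* n ℕ.∸ 2 ℕ.* m))

-- ⌊ n·α ⌋ = #{ m ∈ {1,…,n} : m ≤ n·α }   (valid as 0 ≤ n·α < n).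
countUpTo : (ℕ → Bool) → ℕ → ℕ
countUpTo P zero    = 0
countUpTo P (suc m) = countUpTo P m ℕ.+ (if P (suc m) then 1 else 0)

floorα : ℕ → ℕ
floorα n = countUpTo (leα n) n

fib : ℕ → ℕ
fib n = floorα (suc n) ℕ.∸ floorα n

ℕ→ℚ : ℕ → ℚ
ℕ→ℚ n = (+ n) ℚ./ 1

-- total division (only used with a nonzero denominator)
_÷'_ : ℚ → ℚ → ℚ
p ÷' q with q ≟ℚ 0ℚ
... | yes _  = 0ℚ
... | no q≢0 = _÷_ p q {{ℚ.≢-nonZero q≢0}}

sumTo : (ℕ → ℚ) → ℕ → ℚ
sumTo g zero    = 0ℚ
sumTo g (suc m) = sumTo g m + g (suc m)

-- Σ_{q=a}^{b} g q   (0 if b < a)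
sumRange : (ℕ → ℚ) → ℕ → ℕ → ℚ
sumRange g a b = foldr _+_ 0ℚ (map g (applyUpTo (a ℕ.+_) (suc b ℕ.∸ a)))

module _ (S₀ S₁ S₂ : ℕ) where
  private
    s₀ s₁ s₂ : ℚ
    s₀ = ℕ→ℚ S₀
    s₁ = ℕ→ℚ S₁
    s₂ = ℕ→ℚ S₂

  k₁ k₂ k₃ k₄ k₅ k₆ : ℚ
  k₁ = ½ * s₀ - s₁ + ½ * s₂
  k₂ = ½ * s₀ - ½ * s₂
  k₃ = - (½ * s₀) + ½ * s₂
  k₄ = s₀ - s₁
  k₅ = - s₁ + s₂
  k₆ = 0ℚ

  kj : Fin 6 → ℚ
  kj zero = k₁
  kj (suc zero) = k₂
  kj (suc (suc zero)) = k₃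
  kj (suc (suc (suc zero))) = k₄
  kj (suc (suc (suc (suc zero)))) = k₅
  kj (suc (suc (suc (suc (suc zero))))) = k₆

  kmax : ℚ
  kmax = ∣ k₁ ∣ ⊔ ∣ k₂ ∣ ⊔ ∣ k₃ ∣ ⊔ ∣ k₄ ∣ ⊔ ∣ k₅ ∣ ⊔ ∣ k₆ ∣

  lpar : ℕ
  lpar = ℤ.∣ ceiling ((ℕ→ℚ 2 * (kmax + 1ℚ)) ÷' (s₁ ⊓ (k₁ + s₁))) ∣

  F : ℕ → ℚ
  F n with fib n
  ... | zero  = k₁ + s₁
  ... | suc _ = s₁

  InR : ℕ → ℚ → Set
  InR i x = (sumTo F (i ℕ.∸ 1) + (kmax + 1ℚ) ℚ.≤ x)
          × (x ℚ.≤ sumTo F (i ℕ.∸ 1) + (sumRange F i (i ℕ.+ lpar) - (kmax + 1ℚ)))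

module Submission where

-- R(F[i,i+l-1]) is the window  [A + (k+1), A + B - (k+1)]  with
-- A = Σ_{q<i} F[q]  and  B = Σ_{q=i}^{i+l} F[q].  Every k_j satisfies
-- |k_j| ≤ k, so a point  U + k_j  lies strictly below the window whenever
-- U ≤ A, and strictly above it whenever U ≥ A + B.  Since F ≥ 0 the prefix
-- sums of F are monotone, hence  Σ_{q ≤ i-1-s} F ≤ A  and
-- Σ_{q ≤ i+l+s} F ≥ Σ_{q ≤ i+l} F = A + B,  and neither point can equal x.
-- (The positivity of S₀, S₁, S₂ and the particular value of l are not needed.)

open import Defs
open import Data.Nat using (ℕ; _≤_; _∸_; _+_)
open import Data.Fin using (Fin)
open import Data.Rational using (ℚ) renaming (_+_ to _+ℚ_)
open import Data.Product using (_×_)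
open import Relation.Binary.PropositionalEquality using (_≢_)

open import Data.Nat as ℕ using (zero; suc)
import Data.Nat.Properties as ℕP
open import Data.Fin using (zero; suc)
import Data.Integer as ℤ
open import Data.Rational as ℚ using (mkℚ; 0ℚ; 1ℚ; ½; -_; _-_; ∣_∣; _⊔_)
open import Data.Rational.Properties as ℚP
  using (≤-refl; ≤-trans; ≤-reflexive; <⇒≤; <⇒≢; p≤p⊔q; p≤q⊔p; p≤q⇒p≤q⊔r)
open import Data.Rational.Solver using (module +-*-Solver)
open import Data.Product using (_,_; proj₁; proj₂)
open import Data.List using (foldr; map; applyUpTo)
open import Relation.Binary.PropositionalEquality
  using (_≡_; refl; sym; trans; cong; module ≡-Reasoning)

-∣p∣≤p : ∀ p → - ∣ p ∣ ℚ.≤ p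
-∣p∣≤p p@(mkℚ (ℤ.+ _) _ _)    = ≤-trans (ℚP.neg-antimono-≤ (ℚP.nonNegative⁻¹ p)) (ℚP.nonNegative⁻¹ p)
-∣p∣≤p p@(mkℚ ℤ.-[1+ _ ] _ _) = ≤-refl

p≤∣p∣ : ∀ p → p ℚ.≤ ∣ p ∣
p≤∣p∣ p@(mkℚ (ℤ.+ _) _ _)    = ≤-refl
p≤∣p∣ p@(mkℚ ℤ.-[1+ _ ] _ _) = <⇒≤ (ℚP.<-≤-trans (ℚP.negative⁻¹ p) (ℚP.0≤∣p∣ p))

∣p∣≤K⇒-K≤p≤K : ∀ {p K} → ∣ p ∣ ℚ.≤ K → - K ℚ.≤ p × p ℚ.≤ K
∣p∣≤K⇒-K≤p≤K {p} ∣p∣≤K =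
  ≤-trans (ℚP.neg-antimono-≤ ∣p∣≤K) (-∣p∣≤p p) , ≤-trans (p≤∣p∣ p) ∣p∣≤K

p≤p+q : ∀ p {q} → 0ℚ ℚ.≤ q → p ℚ.≤ p +ℚ q
p≤p+q p 0≤q = ≤-trans (≤-reflexive (sym (ℚP.+-identityʳ p))) (ℚP.+-monoʳ-≤ p 0≤q)

p<p+1 : ∀ p → p ℚ.< p +ℚ 1ℚ
p<p+1 p = ℚP.≤-<-trans (≤-reflexive (sym (ℚP.+-identityʳ p)))
                      (ℚP.+-monoʳ-< p (ℚP.positive⁻¹ 1ℚ))

ℕ→ℚ≥0 : ∀ m → 0ℚ ℚ.≤ ℕ→ℚ m
ℕ→ℚ≥0 m = ℚP.nonNegative⁻¹ (ℕ→ℚ m) {{ℚP.normalize-nonNeg m 1}}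

below-window : ∀ {x A K k U} → U ℚ.≤ A → k ℚ.≤ K →
               A +ℚ (K +ℚ 1ℚ) ℚ.≤ x → U +ℚ k ℚ.< x
below-window {x} {A} {K} {k} {U} U≤A k≤K lo = begin-strict
  U +ℚ k         ≤⟨ ℚP.+-mono-≤ U≤A k≤K ⟩
  A +ℚ K         <⟨ p<p+1 (A +ℚ K) ⟩
  A +ℚ K +ℚ 1ℚ   ≡⟨ ℚP.+-assoc A K 1ℚ ⟩
  A +ℚ (K +ℚ 1ℚ) ≤⟨ lo ⟩
  x              ∎
  where open ℚP.≤-Reasoning

above-window : ∀ {x A B K k U} → A +ℚ B ℚ.≤ U → - K ℚ.≤ k →
               x ℚ.≤ A +ℚ (B - (K +ℚ 1ℚ)) → x ℚ.< U +ℚ k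
above-window {x} {A} {B} {K} {k} {U} A+B≤U -K≤k hi = begin-strict
  x                               ≤⟨ hi ⟩
  A +ℚ (B - (K +ℚ 1ℚ))            <⟨ p<p+1 _ ⟩
  A +ℚ (B - (K +ℚ 1ℚ)) +ℚ 1ℚ      ≡⟨ window-edge A B K ⟩
  A +ℚ B +ℚ (- K)                 ≤⟨ ℚP.+-mono-≤ A+B≤U -K≤k ⟩
  U +ℚ k                          ∎
  where
  open ℚP.≤-Reasoning
  open +-*-Solver
  window-edge : ∀ A B K → A +ℚ (B - (K +ℚ 1ℚ)) +ℚ 1ℚ ≡ A +ℚ B +ℚ (- K)
  window-edge = solve 3 (λ A B K → A :+ (B :- (K :+ con 1ℚ)) :+ con 1ℚ := A :+ B :+ (:- K)) refl

sumTo-mono : (g : ℕ → ℚ) → (∀ n → 0ℚ ℚ.≤ g n) → ∀ {m n} → m ≤ n → sumTo g m ℚ.≤ sumTo g n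
sumTo-mono g g≥0 m≤n = go (ℕP.≤⇒≤′ m≤n)
  where
  go : ∀ {m n} → m ℕ.≤′ n → sumTo g m ℚ.≤ sumTo g n
  go ℕ.≤′-refl          = ≤-refl
  go (ℕ.≤′-step {n} m≤n) = ≤-trans (go m≤n) (p≤p+q (sumTo g n) (g≥0 (suc n)))

-- The block is listed by an
-- index function h with h x = a + 1 + x (kept abstract so the induction can
-- shift it).
sumTo-block : (g : ℕ → ℚ) → ∀ a n (h : ℕ → ℕ) → (∀ x → h x ≡ suc (a + x)) →
              sumTo g a +ℚ foldr _+ℚ_ 0ℚ (map g (applyUpTo h n)) ≡ sumTo g (a + n)
sumTo-block g a zero h h≡ = begin
  sumTo g a +ℚ 0ℚ ≡⟨ ℚP.+-identityʳ (sumTo g a) ⟩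
  sumTo g a       ≡⟨ cong (sumTo g) (sym (ℕP.+-identityʳ a)) ⟩
  sumTo g (a + 0) ∎
  where open ≡-Reasoning
sumTo-block g a (suc n) h h≡ = begin
  sumTo g a +ℚ (g (h 0) +ℚ rest)  ≡⟨ sym (ℚP.+-assoc (sumTo g a) (g (h 0)) rest) ⟩
  sumTo g a +ℚ g (h 0) +ℚ rest    ≡⟨ cong (λ m → sumTo g a +ℚ g m +ℚ rest) first-index ⟩
  sumTo g (suc a) +ℚ rest         ≡⟨ sumTo-block g (suc a) n (λ x → h (suc x)) shifted ⟩
  sumTo g (suc a + n)             ≡⟨ cong (sumTo g) (sym (ℕP.+-suc a n)) ⟩
  sumTo g (a + suc n)             ∎
  where
  open ≡-Reasoning
  rest = foldr _+ℚ_ 0ℚ (map g (applyUpTo (λ x → h (suc x)) n))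
  first-index : h 0 ≡ suc a
  first-index = trans (h≡ 0) (cong suc (ℕP.+-identityʳ a))
  shifted : ∀ x → h (suc x) ≡ suc (suc a + x)
  shifted x = trans (h≡ (suc x)) (cong suc (ℕP.+-suc a x))

sumTo-sumRange : (g : ℕ → ℚ) → ∀ {a b} → a ≤ b →
                 sumTo g a +ℚ sumRange g (suc a) b ≡ sumTo g b
sumTo-sumRange g {a} {b} a≤b =
  trans (sumTo-block g a (b ∸ a) (suc a +_) (λ _ → refl))
        (cong (sumTo g) (ℕP.m+[n∸m]≡n a≤b))

module _ (S₀ S₁ S₂ : ℕ) where

  -- F takes only the nonnegative values k₁ + S₁ = (S₀ + S₂)/2 and S₁.
  F≥0 : ∀ n → 0ℚ ℚ.≤ F S₀ S₁ S₂ n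
  F≥0 n with fib n
  ... | zero  = ≤-trans (ℚP.+-mono-≤ (half≥0 S₀) (half≥0 S₂))
                        (≤-reflexive (sym (k₁+S₁ (ℕ→ℚ S₀) (ℕ→ℚ S₁) (ℕ→ℚ S₂))))
    where
    half≥0 : ∀ m → 0ℚ ℚ.≤ ½ ℚ.* ℕ→ℚ m
    half≥0 m = ℚP.*-monoˡ-≤-nonNeg ½ (ℕ→ℚ≥0 m)
    open +-*-Solver
    k₁+S₁ : ∀ a b c → ½ ℚ.* a - b +ℚ ½ ℚ.* c +ℚ b ≡ ½ ℚ.* a +ℚ ½ ℚ.* c
    k₁+S₁ = solve 3 (λ a b c → con ½ :* a :- b :+ con ½ :* c :+ b := con ½ :* a :+ con ½ :* c) refl
  ... | suc _ = ℕ→ℚ≥0 S₁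

  -- k = max |k_j| bounds every |k_j|: kmax is the left-nested join
  -- a₁ ⊔ … ⊔ a₆, so a_j sits under the j-th join and then climbs out
  -- through the remaining ones (the lifts up₂ … up₅).
  private
    a₁ a₂ a₃ a₄ a₅ a₆ : ℚ
    a₁ = ∣ k₁ S₀ S₁ S₂ ∣
    a₂ = ∣ k₂ S₀ S₁ S₂ ∣
    a₃ = ∣ k₃ S₀ S₁ S₂ ∣
    a₄ = ∣ k₄ S₀ S₁ S₂ ∣
    a₅ = ∣ k₅ S₀ S₁ S₂ ∣
    a₆ = ∣ k₆ S₀ S₁ S₂ ∣

    up₅ : ∀ {p} → p ℚ.≤ a₁ ⊔ a₂ ⊔ a₃ ⊔ a₄ ⊔ a₅ → p ℚ.≤ kmax S₀ S₁ S₂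
    up₅ = p≤q⇒p≤q⊔r a₆
    up₄ : ∀ {p} → p ℚ.≤ a₁ ⊔ a₂ ⊔ a₃ ⊔ a₄ → p ℚ.≤ kmax S₀ S₁ S₂
    up₄ h = up₅ (p≤q⇒p≤q⊔r a₅ h)
    up₃ : ∀ {p} → p ℚ.≤ a₁ ⊔ a₂ ⊔ a₃ → p ℚ.≤ kmax S₀ S₁ S₂
    up₃ h = up₄ (p≤q⇒p≤q⊔r a₄ h)
    up₂ : ∀ {p} → p ℚ.≤ a₁ ⊔ a₂ → p ℚ.≤ kmax S₀ S₁ S₂
    up₂ h = up₃ (p≤q⇒p≤q⊔r a₃ h)

  ∣kj∣≤kmax : ∀ j → ∣ kj S₀ S₁ S₂ j ∣ ℚ.≤ kmax S₀ S₁ S₂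
  ∣kj∣≤kmax zero                                = up₂ (p≤p⊔q a₁ a₂)
  ∣kj∣≤kmax (suc zero)                          = up₂ (p≤q⊔p a₁ a₂)
  ∣kj∣≤kmax (suc (suc zero))                    = up₃ (p≤q⊔p (a₁ ⊔ a₂) a₃)
  ∣kj∣≤kmax (suc (suc (suc zero)))              = up₄ (p≤q⊔p (a₁ ⊔ a₂ ⊔ a₃) a₄)
  ∣kj∣≤kmax (suc (suc (suc (suc zero))))        = up₅ (p≤q⊔p (a₁ ⊔ a₂ ⊔ a₃ ⊔ a₄) a₅)
  ∣kj∣≤kmax (suc (suc (suc (suc (suc zero))))) = p≤q⊔p (a₁ ⊔ a₂ ⊔ a₃ ⊔ a₄ ⊔ a₅) a₆

  -kmax≤kj≤kmax : ∀ j → - kmax S₀ S₁ S₂ ℚ.≤ kj S₀ S₁ S₂ j × kj S₀ S₁ S₂ j ℚ.≤ kmax S₀ S₁ S₂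
  -kmax≤kj≤kmax j = ∣p∣≤K⇒-K≤p≤K (∣kj∣≤kmax j)

-- Writing i = a + 1, the
-- window is based at A = Σ_{q ≤ a} F and ends at Σ_{q ≤ i+l} F.
lemma24 : (S₀ S₁ S₂ : ℕ) → 1 ≤ S₀ → 1 ≤ S₁ → 1 ≤ S₂ →
    (i : ℕ) → 1 ≤ i → (x : ℚ) → InR S₀ S₁ S₂ i x →
    (s : ℕ) → (j : Fin 6) →
    (x ≢ sumTo (F S₀ S₁ S₂) (i ∸ 1 ∸ s) +ℚ kj S₀ S₁ S₂ j)
    × (x ≢ sumTo (F S₀ S₁ S₂) (i + lpar S₀ S₁ S₂ + s) +ℚ kj S₀ S₁ S₂ j)
lemma24 S₀ S₁ S₂ _ _ _ (suc a) _ x (lo , hi) s j =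
  (λ x≡ → <⇒≢ left-point<x (sym x≡)) , <⇒≢ x<right-point
  where
  g : ℕ → ℚ
  g = F S₀ S₁ S₂
  l : ℕ
  l = lpar S₀ S₁ S₂

  left-point<x : sumTo g (a ∸ s) +ℚ kj S₀ S₁ S₂ j ℚ.< x
  left-point<x = below-window (sumTo-mono g (F≥0 S₀ S₁ S₂) (ℕP.m∸n≤m a s))
                              (proj₂ (-kmax≤kj≤kmax S₀ S₁ S₂ j)) lo

  window-end≤ : sumTo g a +ℚ sumRange g (suc a) (suc a + l) ℚ.≤ sumTo g (suc a + l + s)
  window-end≤ = ≤-trans (≤-reflexive (sumTo-sumRange g a≤i+l))
                        (sumTo-mono g (F≥0 S₀ S₁ S₂) (ℕP.m≤m+n (suc a + l) s))
    where
    a≤i+l : a ≤ suc a + l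
    a≤i+l = ℕP.≤-trans (ℕP.n≤1+n a) (ℕP.m≤m+n (suc a) l)

  x<right-point : x ℚ.< sumTo g (suc a + l + s) +ℚ kj S₀ S₁ S₂ j
  x<right-point = above-window {A = sumTo g a} {B = sumRange g (suc a) (suc a + l)}
                               window-end≤ (proj₁ (-kmax≤kj≤kmax S₀ S₁ S₂ j)) hi
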